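{- Let $n\in\mathbb{N}$, let $C_n\subseteq G_n$ and let $A\in C_n$ be an interior point of $C_n$ with respect to its slope bucket (i.e. there exist $B,C\in C_n$ in the same slope bucket as $A$ with $B_x<A_x<C_x$). If there is another point of $C_n$, different from $A$, in the row or in the column of $A$, then $A$ together with two other points of $C_n$ forms an angle of $135^\circ$.
   Context: $G_n=\{(x,y): x,y\in\{1,\dots,n\}\}$; a point is written $P=(P_x,P_y)$; a construction $C_n$ is a subset of $G_n$. A column is a set of points of $G_n$ with a fixed $x$-coordinate, a row a set with a fixed $y$-coordinate. A slope bucket is the set of points of $G_n$ lying on a given line of slope $-1$, i.e. a set $\{(x,y)\in G_n: x+y=c\}$. Three distinct points form an angle of $\theta$ if one of the interior angles of the triangle they span equals $\theta$. -}

module Defs where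

open import Data.Nat using (ℕ)
open import Data.Integer using (ℤ; +_; _+_; _-_; _*_; _<_; _≤_; 0ℤ)
open import Data.Product using (_×_; _,_; proj₁; proj₂)
open import Data.Sum using (_⊎_)
open import Relation.Binary.PropositionalEquality using (_≡_; _≢_)

Point : Set
Point = ℤ × ℤ

px : Point → ℤ
px = proj₁

py : Point → ℤ
py = proj₂

InGrid : ℕ → Point → Set
InGrid n P = (+ 1 ≤ px P × px P ≤ + n) × (+ 1 ≤ py P × py P ≤ + n)

IsConstruction : ℕ → (Point → Set) → Set
IsConstruction n C = ∀ P → C P → InGrid n P

SameRow SameColumn SameSlopeBucket : Point → Point → Set
SameRow P Q = py P ≡ py Q
SameColumn P Q = px P ≡ px Q
-- slope bucket: the line of slope -1, x + y = const
SameSlopeBucket P Q = px P + py P ≡ px Q + py Q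

_⊖_ : Point → Point → Point
P ⊖ Q = (px P - px Q , py P - py Q)

dot : Point → Point → ℤ
dot u w = px u * px w + py u * py w

-- The interior angle of the triangle at vertex V (opposite to P, Q) equals 135°:
-- with u = P - V, w = Q - V (both nonzero), cos∠ = u·w / (|u||w|) = -1/√2,
-- i.e. u·w < 0 and 2 (u·w)² = |u|² |w|².
Angle135At : Point → Point → Point → Set
Angle135At V P Q =
  let u = P ⊖ V ; w = Q ⊖ V
  in (dot u w < 0ℤ) × ((+ 2) * (dot u w * dot u w) ≡ dot u u * dot w w)

FormsAngle135 : Point → Point → Point → Set
FormsAngle135 A B C =
  (A ≢ B × A ≢ C × B ≢ C) ×
  (Angle135At A B C ⊎ Angle135At B A C ⊎ Angle135At C A B)

-- Write u = P - A and w = Q - A.  If P lies in the row or column of A then u is an axis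
-- vector, so |u|² = ℓ² for its component ℓ = u_x - u_y along the antidiagonal (1, -1); if Q
-- lies in the slope bucket of A then w = t (1, -1), so |w|² = 2t² and u·w = ℓt.  Hence
-- 2 (u·w)² = |u|² |w|², and the angle at A is 135° as soon as ℓt < 0.  Since B and D lie on
-- opposite sides of A in its bucket, one of them gives such a t.
module Submission where

open import Defs
open import Data.Nat using (ℕ; z≤n; s≤s)
open import Data.Integer
  using (ℤ; +_; -[1+_]; +[1+_]; _+_; _-_; _*_; -_; 0ℤ; _<_; _≤_; -<+; +<+; +≤+)
open import Data.Integer.Properties
  using (<⇒≱; <-irrefl; +-inverseʳ; +-monoˡ-<; +-mono-≤; i-j≡0⇒i≡j; i≡j⇒i-j≡0; *-zeroʳ; i*j≡0⇒i≡0∨j≡0)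
open import Data.Integer.Tactic.RingSolver using (solve-∀)
open import Data.Product using (_×_; _,_; ∃-syntax)
open import Data.Sum using (_⊎_; inj₁; inj₂; [_,_])
open import Relation.Binary.PropositionalEquality
  using (_≡_; _≢_; refl; sym; trans; cong; cong₂; subst; module ≡-Reasoning)
open ≡-Reasoning

neg*pos<0 : ∀ {i j} → i < 0ℤ → 0ℤ < j → i * j < 0ℤ
neg*pos<0 { -[1+ _ ]} {+[1+ _ ]} _ _ = -<+
neg*pos<0 {+ _} (+<+ ())
neg*pos<0 { -[1+ _ ]} {+ 0} _ (+<+ ())

pos*neg<0 : ∀ {i j} → 0ℤ < i → j < 0ℤ → i * j < 0ℤ
pos*neg<0 {+[1+ _ ]} { -[1+ _ ]} _ _ = -<+
pos*neg<0 {+ 0} (+<+ ())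
pos*neg<0 {+[1+ _ ]} {+ _} _ (+<+ ())

i<j⇒i-j<0 : ∀ {i j} → i < j → i - j < 0ℤ
i<j⇒i-j<0 {i} {j} i<j = subst (i - j <_) (+-inverseʳ j) (+-monoˡ-< (- j) i<j)

i<j⇒0<j-i : ∀ {i j} → i < j → 0ℤ < j - i
i<j⇒0<j-i {i} {j} i<j = subst (_< j - i) (+-inverseʳ i) (+-monoˡ-< (- i) i<j)

i*i≥0 : ∀ i → 0ℤ ≤ i * i
i*i≥0 (+ 0)    = +≤+ z≤n
i*i≥0 +[1+ _ ] = +≤+ z≤n
i*i≥0 -[1+ _ ] = +≤+ z≤n

opposite-sign : ∀ ℓ {s t} → ℓ ≢ 0ℤ → s < 0ℤ → 0ℤ < t → ℓ * s < 0ℤ ⊎ ℓ * t < 0ℤ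
opposite-sign (+ 0) ℓ≢0 _ _ with () ← ℓ≢0 refl
opposite-sign ℓ@(+[1+ _ ]) _ s<0 _ = inj₁ (pos*neg<0 {ℓ} (+<+ (s≤s z≤n)) s<0)
opposite-sign ℓ@(-[1+ _ ]) _ _ 0<t = inj₂ (neg*pos<0 {ℓ} -<+ 0<t)

-- Angle135At V P Q unfolds definitionally to Angle135 (P ⊖ V) (Q ⊖ V).
Angle135 : Point → Point → Set
Angle135 u w = (dot u w < 0ℤ) × ((+ 2) * (dot u w * dot u w) ≡ dot u u * dot w w)

dot-self-nonneg : ∀ u → 0ℤ ≤ dot u u
dot-self-nonneg (a , b) = +-mono-≤ (i*i≥0 a) (i*i≥0 b)

dot-⊖-selfˡ : ∀ V w → dot (V ⊖ V) w ≡ 0ℤ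
dot-⊖-selfˡ (x , y) (a , b) = lemma x y a b
  where
  lemma : ∀ x y a b → (x - x) * a + (y - y) * b ≡ 0ℤ
  lemma = solve-∀

dot-⊖-selfʳ : ∀ u V → dot u (V ⊖ V) ≡ 0ℤ
dot-⊖-selfʳ (a , b) (x , y) = lemma a b x y
  where
  lemma : ∀ a b x y → a * (x - x) + b * (y - y) ≡ 0ℤ
  lemma = solve-∀

⊖≡0⇒≡ : ∀ P A → px (P ⊖ A) ≡ 0ℤ → py (P ⊖ A) ≡ 0ℤ → P ≡ A
⊖≡0⇒≡ (x , y) (x′ , y′) dx≡0 dy≡0 = cong₂ _,_ (i-j≡0⇒i≡j x x′ dx≡0) (i-j≡0⇒i≡j y y′ dy≡0)

-- A 135° angle is never degenerate: u·w < 0 excludes u = 0, w = 0 and u = w.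
angle135At-distinct : ∀ V P Q → Angle135At V P Q → V ≢ P × V ≢ Q × P ≢ Q
angle135At-distinct V P Q (u·w<0 , _) =
    (λ { refl → <-irrefl (dot-⊖-selfˡ V (Q ⊖ V)) u·w<0 })
  , (λ { refl → <-irrefl (dot-⊖-selfʳ (P ⊖ V) V) u·w<0 })
  , (λ { refl → <⇒≱ u·w<0 (dot-self-nonneg (P ⊖ V)) })

axis-dot-self : ∀ a b → a * b ≡ 0ℤ → dot (a , b) (a , b) ≡ (a - b) * (a - b)
axis-dot-self a b ab≡0 = begin
  a * a + b * b                          ≡⟨ square-of-difference a b ⟩
  (a - b) * (a - b) + (+ 2) * (a * b)    ≡⟨ cong (λ z → (a - b) * (a - b) + (+ 2) * z) ab≡0 ⟩
  (a - b) * (a - b) + (+ 2) * 0ℤ         ≡⟨ drop-zero (a - b) ⟩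
  (a - b) * (a - b)                      ∎
  where
  square-of-difference : ∀ a b → a * a + b * b ≡ (a - b) * (a - b) + (+ 2) * (a * b)
  square-of-difference = solve-∀
  drop-zero : ∀ ℓ → ℓ * ℓ + (+ 2) * 0ℤ ≡ ℓ * ℓ
  drop-zero = solve-∀

angle135-axis-antidiagonal : ∀ a b t → a * b ≡ 0ℤ → (a - b) * t < 0ℤ → Angle135 (a , b) (t , - t)
angle135-axis-antidiagonal a b t ab≡0 ℓt<0 =
  subst (_< 0ℤ) (sym (dot-antidiagonal a b t)) ℓt<0 ,
  (begin
    (+ 2) * (dot u w * dot u w)            ≡⟨ cong (λ z → (+ 2) * (z * z)) (dot-antidiagonal a b t) ⟩
    (+ 2) * (((a - b) * t) * ((a - b) * t)) ≡⟨ norms (a - b) t ⟩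
    ((a - b) * (a - b)) * dot w w          ≡⟨ cong (_* dot w w) (sym (axis-dot-self a b ab≡0)) ⟩
    dot u u * dot w w                      ∎)
  where
  u w : Point
  u = a , b
  w = t , - t
  dot-antidiagonal : ∀ a b t → a * t + b * (- t) ≡ (a - b) * t
  dot-antidiagonal = solve-∀
  norms : ∀ ℓ t → (+ 2) * ((ℓ * t) * (ℓ * t)) ≡ (ℓ * ℓ) * (t * t + (- t) * (- t))
  norms = solve-∀

row-or-column-offset : ∀ P A → SameRow P A ⊎ SameColumn P A → px (P ⊖ A) * py (P ⊖ A) ≡ 0ℤ
row-or-column-offset P A (inj₁ row) rewrite i≡j⇒i-j≡0 row = *-zeroʳ (px P - px A)
row-or-column-offset P A (inj₂ col) rewrite i≡j⇒i-j≡0 col = refl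

axis-antidiagonal-zero : ∀ a b → a * b ≡ 0ℤ → a - b ≡ 0ℤ → a ≡ 0ℤ × b ≡ 0ℤ
axis-antidiagonal-zero a b ab≡0 a-b≡0 with i*j≡0⇒i≡0∨j≡0 a ab≡0 | i-j≡0⇒i≡j a b a-b≡0
... | inj₁ a≡0 | a≡b = a≡0 , trans (sym a≡b) a≡0
... | inj₂ b≡0 | a≡b = trans a≡b b≡0 , b≡0

slope-bucket-offset : ∀ Q A → SameSlopeBucket Q A → Q ⊖ A ≡ (px Q - px A , - (px Q - px A))
slope-bucket-offset (x , y) (x′ , y′) x+y≡x′+y′ = cong (x - x′ ,_) (begin
  y - y′                            ≡⟨ shift x y x′ y′ ⟩
  (x + y) - (x′ + y′) - (x - x′)    ≡⟨ cong (λ s → s - (x′ + y′) - (x - x′)) x+y≡x′+y′ ⟩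
  (x′ + y′) - (x′ + y′) - (x - x′)  ≡⟨ cancel (x′ + y′) (x - x′) ⟩
  - (x - x′)                        ∎)
  where
  shift : ∀ x y x′ y′ → y - y′ ≡ (x + y) - (x′ + y′) - (x - x′)
  shift = solve-∀
  cancel : ∀ s d → s - s - d ≡ - d
  cancel = solve-∀

angle135At-row-or-column-bucket :
  ∀ A P Q → SameRow P A ⊎ SameColumn P A → SameSlopeBucket Q A →
  (px (P ⊖ A) - py (P ⊖ A)) * (px Q - px A) < 0ℤ → Angle135At A P Q
angle135At-row-or-column-bucket A P Q P∥A Q∼A ℓt<0 =
  subst (Angle135 (P ⊖ A)) (sym (slope-bucket-offset Q A Q∼A))
    (angle135-axis-antidiagonal (px (P ⊖ A)) (py (P ⊖ A)) (px Q - px A)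
      (row-or-column-offset P A P∥A) ℓt<0)

lemma5 : (n : ℕ) (C : Point → Set) → IsConstruction n C →
         (A : Point) → C A →
         (∃[ B ] ∃[ D ] (C B × C D × SameSlopeBucket B A × SameSlopeBucket D A ×
                         px B < px A × px A < px D)) →
         (∃[ P ] (C P × P ≢ A × (SameRow P A ⊎ SameColumn P A))) →
         ∃[ P ] ∃[ Q ] (C P × C Q × FormsAngle135 A P Q)
lemma5 _ _ _ A _ (B , D , CB , CD , B∼A , D∼A , Bx<Ax , Ax<Dx) (P , CP , P≢A , P∥A) =
  [ (λ ℓtB<0 → P , B , CP , CB , forms135 B B∼A ℓtB<0)
  , (λ ℓtD<0 → P , D , CP , CD , forms135 D D∼A ℓtD<0)
  ] (opposite-sign ℓ ℓ≢0 (i<j⇒i-j<0 Bx<Ax) (i<j⇒0<j-i Ax<Dx))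
  where
  ℓ : ℤ
  ℓ = px (P ⊖ A) - py (P ⊖ A)
  ℓ≢0 : ℓ ≢ 0ℤ
  ℓ≢0 ℓ≡0 with axis-antidiagonal-zero _ _ (row-or-column-offset P A P∥A) ℓ≡0
  ... | dx≡0 , dy≡0 = P≢A (⊖≡0⇒≡ P A dx≡0 dy≡0)
  forms135 : ∀ Q → SameSlopeBucket Q A → ℓ * (px Q - px A) < 0ℤ → FormsAngle135 A P Q
  forms135 Q Q∼A ℓt<0 = angle135At-distinct A P Q angle , inj₁ angle
    where
    angle : Angle135At A P Q
    angle = angle135At-row-or-column-bucket A P Q P∥A Q∼A ℓt<0
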